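{- Let $A = a_1 \ldots a_n$ and $B = b_1 \ldots b_m$ be sequences and $P = p_1 \ldots p_r$ a sequence, all over an alphabet $\Sigma$. Let $C = c_1 \ldots c_\ell$ be a longest common subsequence of $A$ and $B$ among those containing $P$ as a substring (an STR-IC-LCS of $A$, $B$, $P$). Let $(i_1, j_1), \ldots, (i_\ell, j_\ell)$ be index pairs with $i_1 < \cdots < i_\ell$, $j_1 < \cdots < j_\ell$, $C = a_{i_1} \ldots a_{i_\ell} = b_{j_1} \ldots b_{j_\ell}$, and let $q \in [1, \ell - r + 1]$ be such that $P = a_{i_q} a_{i_{q+1}} \ldots a_{i_{q+r-1}} = b_{j_q} \ldots b_{j_{q+r-1}}$. Define $i'_q = i_q$ and, for $t = 1, \ldots, r-1$, let $i'_{q+t}$ be the smallest index in $A$ that is larger than $i'_{q+t-1}$ and satisfies $a_{i'_{q+t}} = a_{i_{q+t}}$. Then the sequence of index pairs $$(i_1, j_1), \ldots, (i_{q-1}, j_{q-1}), (i'_q, j_q), (i'_{q+1}, j_{q+1}), \ldots, (i'_{q+r-1}, j_{q+r-1}), (i_{q+r}, j_{q+r}), \ldots, (i_\ell, j_\ell)$$ defines (i.e., has strictly increasing first and second components and selects equal symbols in $A$ and $B$) a longest common subsequence of $A$ and $B$ containing $P$ as a substring, and this subsequence equals $C$.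
   Context: A subsequence of $X$ is obtained by deleting zero or more symbols of $X$; a substring of $X$ is a contiguous block $\beta$ with $X = \alpha\beta\gamma$. The STR-IC-LCS problem for $A$, $B$, $P$ asks for a common subsequence of $A$ and $B$ of maximal length among those that contain $P$ as a substring. -}

module Defs where

open import Data.Nat using (ℕ; _+_; _<_; _≤_)
open import Data.Fin using (Fin; toℕ) renaming (_<_ to _<ᶠ_)
open import Data.List using (List; _++_; length; lookup; tabulate)
open import Data.List.Relation.Binary.Sublist.Propositional using (_⊆_)
open import Data.Product using (Σ; ∃₂; _×_)
open import Relation.Binary.PropositionalEquality using (_≡_)

IsSubstring : {S : Set} → List S → List S → Set
IsSubstring {S} β X = ∃₂ λ (α γ : List S) → X ≡ α ++ β ++ γ

IsStrICCS : {S : Set} → (A B P C : List S) → Set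
IsStrICCS A B P C = C ⊆ A × C ⊆ B × IsSubstring P C

IsStrICLCS : {S : Set} → (A B P C : List S) → Set
IsStrICLCS {S} A B P C =
  IsStrICCS A B P C × (∀ (D : List S) → IsStrICCS A B P D → length D ≤ length C)

StrictInc : {ℓ n : ℕ} → (Fin ℓ → Fin n) → Set
StrictInc {ℓ} f = ∀ (k k' : Fin ℓ) → k <ᶠ k' → f k <ᶠ f k'

select : {S : Set} → {ℓ : ℕ} → (X : List S) → (Fin ℓ → Fin (length X)) → List S
select X f = tabulate (λ k → lookup X (f k))

module Submission where

-- The heart of the argument is the "leftmost never overtakes" bound
-- i'(k) ≤ i(k), proved by induction on k: i'(k-1) ≤ i(k-1) < i(k), so i(k)
-- is itself a candidate after i'(k-1), and the leftmost candidate i'(k)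
-- cannot lie beyond it.  From this bound, i' increases between consecutive
-- positions (also at the right end of the block), hence is strictly
-- increasing; and i' selects the same symbols as i, so the subsequence it
-- selects is C itself, which is an STR-IC-LCS by assumption.

open import Defs
open import Data.Nat using (ℕ; zero; suc; _+_; _∸_; _<_; _≤_; _≤?_; _<?_; z<s; s≤s⁻¹)
open import Data.Nat.Properties
  using (<-trans; ≤-<-trans; ≤-reflexive; ≤-refl; ≰⇒>; ≮⇒≥; suc-injective;
         m≤n⇒m<n∨m≡n; m∸n+n≡m; +-suc; <⇒≤; <-≤-trans)
open import Data.Fin using (Fin; toℕ; inject₁) renaming (_<_ to _<ᶠ_)
open import Data.Fin.Properties using (toℕ-inject₁)
open import Data.List using (List; length; lookup)
open import Data.List.Properties using (tabulate-cong; tabulate-lookup)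
open import Data.Product using (Σ; _×_; _,_; proj₁; proj₂)
open import Data.Sum using (inj₁; inj₂)
open import Relation.Nullary using (yes; no; ¬_)
open import Relation.Binary.PropositionalEquality
  using (_≡_; _≢_; refl; sym; trans; cong; subst; subst₂)

predecessor : ∀ {L m} (k : Fin L) → m < toℕ k →
              Σ (Fin L) λ k' → toℕ k ≡ suc (toℕ k')
predecessor (Fin.suc k') _ = inject₁ k' , cong suc (sym (toℕ-inject₁ k'))

consecutive⇒StrictInc : ∀ {ℓ n} (f : Fin ℓ → Fin n) →
  (∀ k k' → toℕ k' ≡ suc (toℕ k) → f k <ᶠ f k') → StrictInc f
consecutive⇒StrictInc f step k k' k<k' = walk (toℕ k' ∸ suc (toℕ k)) k' gap
  where
  gap : toℕ k' ≡ suc (toℕ k' ∸ suc (toℕ k) + toℕ k)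
  gap = trans (sym (m∸n+n≡m k<k')) (+-suc _ (toℕ k))

  walk : ∀ d (m : Fin _) → toℕ m ≡ suc (d + toℕ k) → f k <ᶠ f m
  walk zero    m m≡ = step k m m≡
  walk (suc d) m m≡ with predecessor {m = 0} m (subst (0 <_) (sym m≡) z<s)
  ... | m' , m≡1+m' =
    <-trans (walk d m' (suc-injective (trans (sym m≡1+m') m≡)))
            (step m' m m≡1+m')

select-spells : {S : Set} (X Y : List S) (f : Fin (length Y) → Fin (length X)) →
  (∀ k → lookup X (f k) ≡ lookup Y k) → select X f ≡ Y
select-spells X Y f agree = trans (tabulate-cong agree) (tabulate-lookup Y)

data Region {L : ℕ} (q r : ℕ) (k : Fin L) : Set where
  prefix : toℕ k ≤ q → Region q r k
  inside : (k' : Fin L) → toℕ k ≡ suc (toℕ k') →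
           q < toℕ k → toℕ k < q + r → Region q r k
  suffix : q + r ≤ toℕ k → Region q r k

region : ∀ {L} q r (k : Fin L) → Region q r k
region q r k with toℕ k ≤? q
... | yes k≤q = prefix k≤q
... | no k≰q with toℕ k <? q + r
...   | no k≮q+r = suffix (≮⇒≥ k≮q+r)
...   | yes k<q+r with predecessor k (≰⇒> k≰q)
...     | k' , k≡1+k' = inside k' k≡1+k' (≰⇒> k≰q) k<q+r

module Relocation {S : Set} (A C : List S)
  (i i' : Fin (length C) → Fin (length A))
  (i-increasing : StrictInc i)
  (i-spells : ∀ k → lookup A (i k) ≡ lookup C k)
  (q r : ℕ)
  (fixed-before : ∀ k → toℕ k < q → i' k ≡ i k)
  (fixed-after : ∀ k → q + r ≤ toℕ k → i' k ≡ i k)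
  (fixed-start : ∀ k → toℕ k ≡ q → i' k ≡ i k)
  (leftmost : ∀ k k' → q < toℕ k → toℕ k < q + r → toℕ k ≡ 1 + toℕ k' →
     i' k' <ᶠ i' k × lookup A (i' k) ≡ lookup A (i k) ×
     (∀ x → i' k' <ᶠ x → x <ᶠ i' k → lookup A x ≢ lookup A (i k)))
  where

  fixed-prefix : ∀ k → toℕ k ≤ q → i' k ≡ i k
  fixed-prefix k k≤q with m≤n⇒m<n∨m≡n k≤q
  ... | inj₁ k<q = fixed-before k k<q
  ... | inj₂ k≡q = fixed-start k k≡q

  -- Leftmost never overtakes: i'(k) ≤ i(k), by induction on k; the bound
  -- n > k makes the recursion to the predecessor of k structural.
  no-overtaking : ∀ k → toℕ (i' k) ≤ toℕ (i k)
  no-overtaking k = bound (suc (toℕ k)) k ≤-refl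
    where
    bound : ∀ n k → toℕ k < n → toℕ (i' k) ≤ toℕ (i k)
    bound zero    k ()
    bound (suc n) k k<n with region q r k
    ... | prefix k≤q = ≤-reflexive (cong toℕ (fixed-prefix k k≤q))
    ... | suffix q+r≤k = ≤-reflexive (cong toℕ (fixed-after k q+r≤k))
    ... | inside k' k≡1+k' q<k k<q+r = ≮⇒≥ overtakes⇒candidate-skipped
      where
      -- i(k) lies after i'(k') and carries the wanted symbol, so it cannot
      -- be strictly between i'(k') and the leftmost choice i'(k).
      i'k'<ik : i' k' <ᶠ i k
      i'k'<ik = ≤-<-trans (bound n k' (s≤s⁻¹ (subst (_< suc n) k≡1+k' k<n)))
                          (i-increasing k' k (≤-reflexive (sym k≡1+k')))
      overtakes⇒candidate-skipped : ¬ (i k <ᶠ i' k)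
      overtakes⇒candidate-skipped ik<i'k =
        proj₂ (proj₂ (leftmost k k' q<k k<q+r k≡1+k')) (i k) i'k'<ik ik<i'k refl

  -- i' increases between consecutive positions k and k' = k + 1: in the
  -- prefix because i does, inside the block by the leftmost choice, and after
  -- it because i'(k) ≤ i(k) < i(k') = i'(k').
  step : ∀ k k' → toℕ k' ≡ suc (toℕ k) → i' k <ᶠ i' k'
  step k k' k'≡1+k with region q r k'
  ... | prefix k'≤q =
    subst₂ _<ᶠ_ (sym (fixed-prefix k (<⇒≤ (<-≤-trans k<k' k'≤q))))
                (sym (fixed-prefix k' k'≤q)) (i-increasing k k' k<k')
    where k<k' = ≤-reflexive (sym k'≡1+k)
  ... | inside _ _ q<k' k'<q+r = proj₁ (leftmost k' k q<k' k'<q+r k'≡1+k)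
  ... | suffix q+r≤k' =
    subst (i' k <ᶠ_) (sym (fixed-after k' q+r≤k'))
      (≤-<-trans (no-overtaking k) (i-increasing k k' (≤-reflexive (sym k'≡1+k))))

  i'-increasing : StrictInc i'
  i'-increasing = consecutive⇒StrictInc i' step

  i'-spells : ∀ k → lookup A (i' k) ≡ lookup C k
  i'-spells k with region q r k
  ... | prefix k≤q = trans (cong (lookup A) (fixed-prefix k k≤q)) (i-spells k)
  ... | suffix q+r≤k = trans (cong (lookup A) (fixed-after k q+r≤k)) (i-spells k)
  ... | inside k' k≡1+k' q<k k<q+r =
    trans (proj₁ (proj₂ (leftmost k k' q<k k<q+r k≡1+k'))) (i-spells k)

lemma1 : {S : Set} (A B P C : List S) →
    IsStrICLCS A B P C →
    (i : Fin (length C) → Fin (length A)) →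
    (j : Fin (length C) → Fin (length B)) →
    StrictInc i → StrictInc j →
    (∀ (k : Fin (length C)) → lookup A (i k) ≡ lookup C k) →
    (∀ (k : Fin (length C)) → lookup B (j k) ≡ lookup C k) →
    (q : ℕ) → q + length P ≤ length C →
    (∀ (t : Fin (length P)) (k : Fin (length C)) → toℕ k ≡ q + toℕ t →
      lookup P t ≡ lookup A (i k) × lookup P t ≡ lookup B (j k)) →
    (i' : Fin (length C) → Fin (length A)) →
    (∀ (k : Fin (length C)) → toℕ k < q → i' k ≡ i k) →
    (∀ (k : Fin (length C)) → q + length P ≤ toℕ k → i' k ≡ i k) →
    (∀ (k : Fin (length C)) → toℕ k ≡ q → i' k ≡ i k) →
    (∀ (k k' : Fin (length C)) → q < toℕ k → toℕ k < q + length P →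
      toℕ k ≡ 1 + toℕ k' →
      i' k' <ᶠ i' k × lookup A (i' k) ≡ lookup A (i k) ×
      (∀ (x : Fin (length A)) → i' k' <ᶠ x → x <ᶠ i' k →
        lookup A x ≢ lookup A (i k))) →
    StrictInc i' × StrictInc j ×
    (∀ (k : Fin (length C)) → lookup A (i' k) ≡ lookup B (j k)) ×
    IsStrICLCS A B P (select A i') ×
    select A i' ≡ C
lemma1 A B P C isLCS i j i-inc j-inc i-spells j-spells q _ _
       i' before after start leftmost =
  i'-increasing , j-inc , i'-matches-j ,
  subst (IsStrICLCS A B P) (sym spells-C) isLCS , spells-C
  where
  open Relocation A C i i' i-inc i-spells q (length P) before after start leftmost

  spells-C : select A i' ≡ C
  spells-C = select-spells A C i' i'-spells

  i'-matches-j : ∀ k → lookup A (i' k) ≡ lookup B (j k)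
  i'-matches-j k = trans (i'-spells k) (sym (j-spells k))
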